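{- Let $\mathcal{A}_{\mathbf S}$ be an almost transitive deformation of the braid arrangement in $\mathbb{R}^n$ and let $T\in\mathcal{T}^{(m)}(n)$. Suppose $(v_1,v_2,\dots,v_k)$ and $(v_k,v_{k+1},\dots,v_{k+\ell})$ are $\mathbf S$-cadet sequences of $T$. If either $v_k=1$ or neither sequence contains the node $1$, then $(v_1,v_2,\dots,v_{k+\ell})$ is an $\mathbf S$-cadet sequence of $T$.
   Context: A deformation of the braid arrangement in $\mathbb{R}^n$ is a finite set $\mathcal{A}$ of hyperplanes $x_i-x_j=s$ ($1\le i<j\le n$, $s\in\mathbb{Z}$), encoded by $\mathbf S=(S_{i,j})_{i<j}$, $S_{i,j}=\{s:(x_i-x_j=s)\in\mathcal{A}\}$, written $\mathcal{A}_{\mathbf S}$. For $i<j$: $S^-_{i,j}:=\{s\ge0:-s\in S_{i,j}\}$, $S^-_{j,i}:=\{0\}\cup\{s>0:s\in S_{i,j}\}$. $m=\max\{|s|:s\in\bigcup S_{i,j}\}$. $\mathcal{A}_{\mathbf S}$ is almost transitive if for all distinct $i,j,k\in[n]$ with $1\notin\{i,k\}$ and all nonnegative integers $s\notin S^-_{i,j}$, $t\notin S^-_{j,k}$, we have $s+t\notin S^-_{i,k}$. $\mathcal{T}^{(m)}(n)$: rooted plane trees whose vertices are nodes (exactly $m+1$ ordered children) or leaves, with $n$ nodes labeled bijectively by $1,\dots,n$. $\mathsf{cadet}(u)$: rightmost child of node $u$ that is a node, if any. $\mathsf{lsib}(v)$: number of children of the parent of $v$ to the left of $v$. A cadet sequence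 is a sequence of nodes $(v_1,\dots,v_k)$ with $v_p=\mathsf{cadet}(v_{p-1})$; it is an $\mathbf S$-cadet sequence if $\sum_{p=i+1}^{j}\mathsf{lsib}(v_p)\notin S^-_{v_i,v_j}$ for all $i<j$. -}

module Defs where

open import Data.Nat using (ℕ; zero; suc; _<_; _≤_; _≡ᵇ_; _<ᵇ_; _⊔_)
open import Data.Nat.Properties using (<-cmp)
open import Data.Integer using (ℤ; +_; -_; ∣_∣)
open import Data.Nat.ListAction using (sum)
open import Data.List using (List; []; _∷_; _++_; [_]; map; upTo; foldr; concatMap)
open import Data.List.Membership.Propositional using (_∈_)
open import Data.List.Relation.Unary.All using (All)
open import Data.List.Relation.Binary.Permutation.Propositional using (_↭_)
open import Data.Vec using (Vec; []; _∷_)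
open import Data.Maybe using (Maybe; just; nothing; _<∣>_; fromMaybe)
open import Data.Bool using (if_then_else_)
open import Data.Sum using (_⊎_)
open import Data.Product using (_×_)
open import Data.Empty using (⊥)
open import Relation.Nullary using (¬_)
open import Relation.Binary.PropositionalEquality using (_≡_; _≢_)
open import Relation.Binary.Definitions using (tri<; tri≈; tri>)

-- Deformations of the braid arrangement.
-- S i j : the (finite) list of integers s with (x_i - x_j = s) ∈ A,
-- meaningful only for 1 ≤ i < j ≤ n (other entries are ignored).

Deformation : Set
Deformation = ℕ → ℕ → List ℤ

Sminus : Deformation → ℕ → ℕ → ℕ → Set
Sminus S a b s with <-cmp a b
... | tri< _ _ _ = (- (+ s)) ∈ S a b
... | tri≈ _ _ _ = ⊥
... | tri> _ _ _ = (s ≡ 0) ⊎ ((0 < s) × ((+ s) ∈ S b a))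

range : ℕ → List ℕ
range n = map suc (upTo n)

maxShift : ℕ → Deformation → ℕ
maxShift n S =
  foldr _⊔_ 0
    (concatMap (λ i → concatMap (λ j → if i <ᵇ j then map ∣_∣ (S i j) else []) (range n))
               (range n))

AlmostTransitive : ℕ → Deformation → Set
AlmostTransitive n S =
  ∀ i j k → 1 ≤ i → i ≤ n → 1 ≤ j → j ≤ n → 1 ≤ k → k ≤ n →
  i ≢ j → j ≢ k → i ≢ k → i ≢ 1 → k ≢ 1 →
  ∀ (s t : ℕ) → ¬ Sminus S i j s → ¬ Sminus S j k t → ¬ Sminus S i k (s Data.Nat.+ t)

-- Rooted plane trees: every node has exactly r ordered children
-- (r = m + 1); nodes carry natural-number labels.

data Tree (r : ℕ) : Set where
  leaf : Tree r
  node : ℕ → Vec (Tree r) r → Tree r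

module _ {r : ℕ} where
  mutual
    labels : Tree r → List ℕ
    labels leaf = []
    labels (node u cs) = u ∷ labelsV cs

    labelsV : ∀ {l} → Vec (Tree r) l → List ℕ
    labelsV [] = []
    labelsV (t ∷ ts) = labels t ++ labelsV ts

  mutual
    childrenOf : Tree r → ℕ → Maybe (List (Tree r))
    childrenOf leaf u = nothing
    childrenOf (node v cs) u =
      if v ≡ᵇ u then just (toL cs) else childrenOfV cs u

    childrenOfV : ∀ {l} → Vec (Tree r) l → ℕ → Maybe (List (Tree r))
    childrenOfV [] u = nothing
    childrenOfV (t ∷ ts) u = childrenOf t u <∣> childrenOfV ts u

    toL : ∀ {l} → Vec (Tree r) l → List (Tree r)
    toL [] = []
    toL (t ∷ ts) = t ∷ toL ts

  rightmostNode : List (Tree r) → Maybe ℕ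
  rightmostNode [] = nothing
  rightmostNode (t ∷ ts) with rightmostNode ts
  ... | just v = just v
  ... | nothing with t
  ...   | leaf = nothing
  ...   | node v _ = just v

  cadet : Tree r → ℕ → Maybe ℕ
  cadet T u with childrenOf T u
  ... | nothing = nothing
  ... | just cs = rightmostNode cs

  positionIn : ℕ → List (Tree r) → Maybe ℕ
  positionIn v [] = nothing
  positionIn v (leaf ∷ ts) = Data.Maybe.map suc (positionIn v ts)
  positionIn v (node u _ ∷ ts) =
    if u ≡ᵇ v then just 0 else Data.Maybe.map suc (positionIn v ts)

  mutual
    lsibM : Tree r → ℕ → Maybe ℕ
    lsibM leaf v = nothing
    lsibM (node u cs) v = positionIn v (toL cs) <∣> lsibMV cs v

    lsibMV : ∀ {l} → Vec (Tree r) l → ℕ → Maybe ℕ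
    lsibMV [] v = nothing
    lsibMV (t ∷ ts) v = lsibM t v <∣> lsibMV ts v

  -- lsib(v): number of children of the parent of v to the left of v
  -- (set to 0 for the root / absent labels, where it is never used)
  lsib : Tree r → ℕ → ℕ
  lsib T v = fromMaybe 0 (lsibM T v)

-- T ∈ T^(m)(n): arity m+1 and the n node labels are exactly 1..n (bijectively)
InTrees : ℕ → ∀ {r} → Tree r → Set
InTrees n T = labels T ↭ range n

IsCadetSeq : ∀ {r} → Tree r → List ℕ → Set
IsCadetSeq T vs =
  All (λ v → v ∈ labels T) vs ×
  (∀ as u w zs → vs ≡ as ++ u ∷ w ∷ zs → cadet T u ≡ just w)

IsSCadetSeq : Deformation → ∀ {r} → Tree r → List ℕ → Set
IsSCadetSeq S T vs =
  IsCadetSeq T vs ×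
  (∀ as u ys w zs → vs ≡ as ++ u ∷ ys ++ w ∷ zs →
     ¬ Sminus S u w (sum (map (lsib T) (ys ++ [ w ]))))

{-# OPTIONS --safe #-}
-- The labels of T are distinct, so a cadet step u ↦ w moves to a child of u and strictly
-- shrinks the set of descendants; hence the entries of a cadet sequence are pairwise distinct.
-- In the concatenation, adjacent pairs and S-conditions for pairs lying in one half are
-- inherited. For u in the first half and w in the second, the lsib-sum from u to w splits
-- at the junction x into the sums for (u, x) and (x, w); since u, x, w are distinct and
-- neither u nor w is 1 (either x = 1, or 1 occurs in neither half), almost transitivity
-- at (u, x, w) gives the S-condition for (u, w).
module Submission where

open import Defs
open import Data.Nat using (ℕ; suc; _<_; _≤_; _+_; _≡ᵇ_; s≤s; z≤n)
open import Data.Nat.Properties using (≡ᵇ⇒≡; ≡⇒≡ᵇ; suc-injective; m≤m+n; m≤n+m; ≤-trans; <-trans; <-irrefl)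
open import Data.Nat.ListAction using (sum)
open import Data.Nat.ListAction.Properties using (sum-++)
open import Data.List using (List; []; _∷_; _++_; _∷ʳ_; [_]; map; length)
open import Data.List.Properties using (++-assoc; ++-identityʳ; length-++; map-++; ∷-injective)
open import Data.List.Membership.Propositional using (_∈_; _∉_)
open import Data.List.Membership.Propositional.Properties using (∈-map⁻; ∈-++⁺ˡ; ∈-++⁺ʳ; ∈-upTo⁻)
open import Data.List.Relation.Unary.Any using (here; there)
import Data.List.Relation.Unary.All as All
import Data.List.Relation.Unary.All.Properties as All
open import Data.List.Relation.Unary.AllPairs using (_∷_)
open import Data.List.Relation.Unary.Unique.Propositional using (Unique)
import Data.List.Relation.Unary.Unique.Propositional.Properties as Unique
open import Data.List.Relation.Binary.Disjoint.Propositional using (Disjoint)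
open import Data.List.Relation.Binary.Permutation.Propositional using (↭-sym; ↭⇒↭ₛ)
open import Data.List.Relation.Binary.Permutation.Propositional.Properties using (∈-resp-↭)
open import Data.List.Relation.Binary.Permutation.Setoid.Properties using (Unique-resp-↭)
open import Data.Vec using (Vec; []; _∷_)
open import Data.Maybe using (just; nothing; fromMaybe)
open import Data.Bool using (true; false; T)
open import Data.Bool.Properties using (T-≡)
open import Data.Sum using (_⊎_; inj₁; inj₂)
open import Data.Product using (_×_; _,_; ∃; ∃₂; proj₁; proj₂)
open import Function using (Equivalence; case_of_)
open import Relation.Nullary using (¬_; contradiction)
open import Relation.Binary.PropositionalEquality
  using (_≡_; _≢_; refl; sym; trans; cong; subst; setoid; module ≡-Reasoning)

module _ {A : Set} where

  ++-∷-split : ∀ xs (x : A) ys as u R → xs ++ x ∷ ys ≡ as ++ u ∷ R →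
    (∃ λ bs → as ≡ xs ++ bs × x ∷ ys ≡ bs ++ u ∷ R) ⊎
    (∃ λ bs → xs ≡ as ++ u ∷ bs × R ≡ bs ++ x ∷ ys)
  ++-∷-split []       x ys as       u R e = inj₁ (as , refl , e)
  ++-∷-split (y ∷ xs) x ys []       u R e with refl , e′ ← ∷-injective e = inj₂ (xs , refl , sym e′)
  ++-∷-split (y ∷ xs) x ys (a ∷ as) u R e with refl , e′ ← ∷-injective e
    with ++-∷-split xs x ys as u R e′
  ... | inj₁ (bs , refl , e″) = inj₁ (bs , refl , e″)
  ... | inj₂ (bs , refl , e″) = inj₂ (bs , refl , e″)

  Unique-++⁻ : ∀ (xs ys : List A) → Unique (xs ++ ys) → Unique xs × Unique ys × Disjoint xs ys
  Unique-++⁻ []       ys u = Unique.[] , u , λ ()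
  Unique-++⁻ (x ∷ xs) ys (x∉ ∷ u) with uxs , uys , disj ← Unique-++⁻ xs ys u =
    All.++⁻ˡ xs x∉ ∷ uxs , uys ,
    λ { (here refl , x∈ys) → All.lookup (All.++⁻ʳ xs x∉) x∈ys refl
      ; (there x∈xs , x∈ys) → disj (x∈xs , x∈ys) }

  Adjacent : (A → A → Set) → List A → Set
  Adjacent R vs = ∀ as u w zs → vs ≡ as ++ u ∷ w ∷ zs → R u w

  OrderedPairs : (A → List A → A → Set) → List A → Set
  OrderedPairs R vs = ∀ as u mid w zs → vs ≡ as ++ u ∷ mid ++ w ∷ zs → R u mid w

  module _ {R : A → A → Set} where

    Adjacent-++⁻ʳ : ∀ bs {vs} → Adjacent R (bs ++ vs) → Adjacent R vs
    Adjacent-++⁻ʳ bs adj as u w zs e =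
      adj (bs ++ as) u w zs (trans (cong (bs ++_) e) (sym (++-assoc bs as _)))

    Adjacent-++-∷ : ∀ {xs x ys} → Adjacent R (xs ∷ʳ x) → Adjacent R (x ∷ ys) →
      Adjacent R (xs ++ x ∷ ys)
    Adjacent-++-∷ {xs} {x} {ys} adj₁ adj₂ as u w zs e with ++-∷-split xs x ys as u (w ∷ zs) e
    ... | inj₁ (bs , _ , e′) = adj₂ bs u w zs e′
    ... | inj₂ ([] , refl , refl) = adj₁ as u x [] (++-assoc as [ u ] [ x ])
    ... | inj₂ (.w ∷ bs , refl , refl) = adj₁ as u w (bs ∷ʳ x) (++-assoc as (u ∷ w ∷ bs) [ x ])

    module _ (f : A → ℕ) (descends : ∀ {u w} → R u w → f w < f u) where

      Adjacent-descending : ∀ u mid w zs → Adjacent R (u ∷ mid ++ w ∷ zs) → f w < f u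
      Adjacent-descending u []      w zs adj = descends (adj [] u w zs refl)
      Adjacent-descending u (v ∷ mid) w zs adj =
        <-trans (Adjacent-descending v mid w zs (Adjacent-++⁻ʳ [ u ] adj))
                (descends (adj [] u v (mid ++ w ∷ zs) refl))

      Adjacent-distinct : ∀ {vs} → Adjacent R vs → OrderedPairs (λ u _ w → u ≢ w) vs
      Adjacent-distinct adj as u mid w zs refl refl =
        <-irrefl refl (Adjacent-descending u mid u zs (Adjacent-++⁻ʳ as adj))

  OrderedPairs-++-∷ : ∀ {R xs x ys} → OrderedPairs R (xs ∷ʳ x) → OrderedPairs R (x ∷ ys) →
    (∀ as u p q w zs → xs ≡ as ++ u ∷ p → ys ≡ q ++ w ∷ zs → R u (p ++ x ∷ q) w) →
    OrderedPairs R (xs ++ x ∷ ys)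
  OrderedPairs-++-∷ {R} {xs} {x} {ys} ord₁ ord₂ straddle as u mid w zs e
    with ++-∷-split xs x ys as u (mid ++ w ∷ zs) e
  ... | inj₁ (bs , _ , e′) = ord₂ bs u mid w zs e′
  ... | inj₂ (p , refl , e′) with ++-∷-split p x ys mid w zs (sym e′)
  ...   | inj₂ (bs , refl , refl) =
          ord₁ as u mid w (bs ∷ʳ x)
            (trans (++-assoc as (u ∷ mid ++ w ∷ bs) [ x ])
                   (cong (λ L → as ++ u ∷ L) (++-assoc mid (w ∷ bs) [ x ])))
  ...   | inj₁ ([] , refl , refl) =
          subst (λ L → R u L x) (sym (++-identityʳ p))
            (ord₁ as u p x [] (++-assoc as (u ∷ p) [ x ]))
  ...   | inj₁ (_ ∷ q , refl , e″) with refl , ys≡ ← ∷-injective e″ =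
          straddle as u p q w zs refl ys≡

≢⇒≡ᵇ-false : ∀ {m n} → m ≢ n → (m ≡ᵇ n) ≡ false
≢⇒≡ᵇ-false {m} {n} m≢n with m ≡ᵇ n in eq
... | true  = contradiction (≡ᵇ⇒≡ m n (subst T (sym eq) _)) m≢n
... | false = refl

≡ᵇ-refl : ∀ n → (n ≡ᵇ n) ≡ true
≡ᵇ-refl n = Equivalence.to T-≡ (≡⇒≡ᵇ n n refl)

module _ {r : ℕ} where

  data Subtree (s : Tree r) : Tree r → Set where
    self  : Subtree s s
    child : ∀ {v cs c} → c ∈ toL cs → Subtree s c → Subtree s (node v cs)

  labelsL : List (Tree r) → List ℕ
  labelsL []       = []
  labelsL (t ∷ ts) = labels t ++ labelsL ts

  labelsL-toL : ∀ {l} (cs : Vec (Tree r) l) → labelsL (toL cs) ≡ labelsV cs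
  labelsL-toL []       = refl
  labelsL-toL (t ∷ ts) = cong (labels t ++_) (labelsL-toL ts)

  length-labels≤ : ∀ {c cs} → c ∈ cs → length (labels c) ≤ length (labelsL cs)
  length-labels≤ {c} {_ ∷ ts} (here refl) rewrite length-++ (labels c) {labelsL ts} = m≤m+n _ _
  length-labels≤ {c} {t ∷ ts} (there c∈) rewrite length-++ (labels t) {labelsL ts} =
    ≤-trans (length-labels≤ c∈) (m≤n+m _ _)

  labels-child⊆ : ∀ {l} (cs : Vec (Tree r) l) {c x} → c ∈ toL cs → x ∈ labels c → x ∈ labelsV cs
  labels-child⊆ (t ∷ ts) (here refl) x∈ = ∈-++⁺ˡ x∈
  labels-child⊆ (t ∷ ts) (there c∈) x∈ = ∈-++⁺ʳ (labels t) (labels-child⊆ ts c∈ x∈)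

  Subtree-root∈labels : ∀ {w ws t} → Subtree (node w ws) t → w ∈ labels t
  Subtree-root∈labels self                     = here refl
  Subtree-root∈labels (child {cs = cs} c∈ sub) = there (labels-child⊆ cs c∈ (Subtree-root∈labels sub))

  mutual
    childrenOf-∉ : ∀ t {w} → w ∉ labels t → childrenOf t w ≡ nothing
    childrenOf-∉ leaf        w∉ = refl
    childrenOf-∉ (node v cs) w∉ rewrite ≢⇒≡ᵇ-false (λ v≡w → w∉ (here (sym v≡w))) =
      childrenOfV-∉ cs (λ w∈ → w∉ (there w∈))

    childrenOfV-∉ : ∀ {l} (cs : Vec (Tree r) l) {w} → w ∉ labelsV cs → childrenOfV cs w ≡ nothing
    childrenOfV-∉ []       w∉ = refl
    childrenOfV-∉ (t ∷ ts) w∉ rewrite childrenOf-∉ t (λ w∈ → w∉ (∈-++⁺ˡ w∈)) =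
      childrenOfV-∉ ts (λ w∈ → w∉ (∈-++⁺ʳ (labels t) w∈))

  -- With repeated labels, childrenOf would only see the first occurrence of w.
  mutual
    childrenOf-Subtree : ∀ {w ws} t → Unique (labels t) → Subtree (node w ws) t →
      childrenOf t w ≡ just (toL ws)
    childrenOf-Subtree {w} (node w ws) _ self rewrite ≡ᵇ-refl w = refl
    childrenOf-Subtree {w} (node v cs) (v∉ ∷ u) (child c∈ sub)
      rewrite ≢⇒≡ᵇ-false {v} {w} (λ { refl → All.lookup v∉ (labels-child⊆ cs c∈ (Subtree-root∈labels sub)) refl }) =
      childrenOfV-Subtree cs u c∈ sub

    childrenOfV-Subtree : ∀ {l w ws c} (cs : Vec (Tree r) l) → Unique (labelsV cs) →
      c ∈ toL cs → Subtree (node w ws) c → childrenOfV cs w ≡ just (toL ws)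
    childrenOfV-Subtree (t ∷ ts) u c∈ sub with Unique-++⁻ (labels t) (labelsV ts) u | c∈
    ... | ut , _ , _ | here refl rewrite childrenOf-Subtree t ut sub = refl
    ... | _ , uts , disj | there c∈′
      rewrite childrenOf-∉ t (λ w∈ → disj (w∈ , labels-child⊆ ts c∈′ (Subtree-root∈labels sub))) =
      childrenOfV-Subtree ts uts c∈′ sub

  mutual
    childrenOf⇒Subtree : ∀ t {u cs c} → childrenOf t u ≡ just cs → c ∈ cs → Subtree c t
    childrenOf⇒Subtree leaf () c∈
    childrenOf⇒Subtree (node v cs′) {u} e c∈ with v ≡ᵇ u
    childrenOf⇒Subtree (node v cs′) refl c∈ | true = child c∈ self
    childrenOf⇒Subtree (node v cs′) e c∈ | false with c′ , c′∈ , sub ← childrenOfV⇒Subtree cs′ e c∈ =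
      child c′∈ sub

    childrenOfV⇒Subtree : ∀ {l} (cs : Vec (Tree r) l) {u L c} → childrenOfV cs u ≡ just L → c ∈ L →
      ∃ λ c′ → c′ ∈ toL cs × Subtree c c′
    childrenOfV⇒Subtree [] () c∈
    childrenOfV⇒Subtree (t ∷ ts) {u} e c∈ with childrenOf t u in eq
    childrenOfV⇒Subtree (t ∷ ts) refl c∈ | just _ = t , here refl , childrenOf⇒Subtree t eq c∈
    childrenOfV⇒Subtree (t ∷ ts) e c∈ | nothing with c′ , c′∈ , sub ← childrenOfV⇒Subtree ts e c∈ =
      c′ , there c′∈ , sub

  rightmostNode-∈ : ∀ (cs : List (Tree r)) {w} → rightmostNode cs ≡ just w → ∃ λ ws → node w ws ∈ cs
  rightmostNode-∈ [] ()
  rightmostNode-∈ (t ∷ ts) e with rightmostNode ts in eq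
  rightmostNode-∈ (t ∷ ts) refl | just v with ws , w∈ ← rightmostNode-∈ ts eq = ws , there w∈
  rightmostNode-∈ (t ∷ ts) e | nothing with t
  rightmostNode-∈ (t ∷ ts) () | nothing | leaf
  rightmostNode-∈ (t ∷ ts) refl | nothing | node v vs = vs , here refl

  cadet⇒child : ∀ t {u w} → cadet t u ≡ just w →
    ∃₂ λ (cs : List (Tree r)) (ws : Vec (Tree r) r) → childrenOf t u ≡ just cs × node w ws ∈ cs
  cadet⇒child t {u} e with childrenOf t u
  ... | just cs with ws , w∈ ← rightmostNode-∈ cs e = cs , ws , refl , w∈
  cadet⇒child t () | nothing

  descendants : Tree r → ℕ → List ℕ
  descendants t u = labelsL (fromMaybe [] (childrenOf t u))

  cadet-descendants-< : ∀ {t} → Unique (labels t) → ∀ {u w} → cadet t u ≡ just w →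
    length (descendants t w) < length (descendants t u)
  cadet-descendants-< {t} ut e with cadet⇒child t e
  ... | cs , ws , ch , w∈
    rewrite ch | childrenOf-Subtree t ut (childrenOf⇒Subtree t ch w∈) | labelsL-toL ws =
    length-labels≤ w∈

labels-unique : ∀ n {r} {t : Tree r} → InTrees n t → Unique (labels t)
labels-unique n inT =
  Unique-resp-↭ (setoid ℕ) (↭⇒↭ₛ (↭-sym inT)) (Unique.map⁺ suc-injective (Unique.upTo⁺ n))

labels-bounded : ∀ n {r} {t : Tree r} → InTrees n t → ∀ {v} → v ∈ labels t → 1 ≤ v × v ≤ n
labels-bounded n inT v∈ with k , k∈ , refl ← ∈-map⁻ suc (∈-resp-↭ inT v∈) = s≤s z≤n , ∈-upTo⁻ k∈

sum-map-++-∷ : ∀ (f : ℕ → ℕ) p x q w →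
  sum (map f ((p ++ x ∷ q) ++ [ w ])) ≡ sum (map f (p ++ [ x ])) + sum (map f (q ++ [ w ]))
sum-map-++-∷ f p x q w = begin
  sum (map f ((p ++ x ∷ q) ++ [ w ]))             ≡⟨ cong (λ L → sum (map f L)) regroup ⟩
  sum (map f ((p ++ [ x ]) ++ q ++ [ w ]))         ≡⟨ cong sum (map-++ f (p ++ [ x ]) (q ++ [ w ])) ⟩
  sum (map f (p ++ [ x ]) ++ map f (q ++ [ w ]))   ≡⟨ sum-++ (map f (p ++ [ x ])) (map f (q ++ [ w ])) ⟩
  sum (map f (p ++ [ x ])) + sum (map f (q ++ [ w ])) ∎
  where
  open ≡-Reasoning
  regroup : (p ++ x ∷ q) ++ [ w ] ≡ (p ++ [ x ]) ++ q ++ [ w ]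
  regroup = trans (++-assoc p (x ∷ q) [ w ]) (sym (++-assoc p [ x ] (q ++ [ w ])))

IsSCadetSeq-straddle : ∀ {n S} → AlmostTransitive n S → ∀ {r} {T : Tree r} → InTrees n T →
  ∀ {xs x ys} → IsSCadetSeq S T (xs ∷ʳ x) → IsSCadetSeq S T (x ∷ ys) →
  (x ≡ 1 ⊎ (1 ∉ (xs ∷ʳ x) × 1 ∉ (x ∷ ys))) →
  ∀ as u p q w zs → xs ≡ as ++ u ∷ p → ys ≡ q ++ w ∷ zs →
  ¬ Sminus S u w (sum (map (lsib T) ((p ++ x ∷ q) ++ [ w ])))
IsSCadetSeq-straddle {n} {S} at {T = T} inT {x = x} ((in₁ , adj₁) , ord₁) ((in₂ , adj₂) , ord₂) one
  as u p q w zs refl refl =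
  subst (λ s → ¬ Sminus S u w s) (sym (sum-map-++-∷ (lsib T) p x q w))
    (at u x w (proj₁ u-bounds) (proj₂ u-bounds) (proj₁ x-bounds) (proj₂ x-bounds)
        (proj₁ w-bounds) (proj₂ w-bounds) u≢x x≢w u≢w u≢1 w≢1 _ _
        (ord₁ as u p x [] (++-assoc as (u ∷ p) [ x ])) (ord₂ [] x q w zs refl))
  where
  distinct : OrderedPairs (λ v _ v′ → v ≢ v′) ((as ++ u ∷ p) ++ x ∷ q ++ w ∷ zs)
  distinct = Adjacent-distinct (λ v → length (descendants T v))
    (cadet-descendants-< (labels-unique n inT)) (Adjacent-++-∷ adj₁ adj₂)

  u≢x : u ≢ x
  u≢x = distinct as u p x (q ++ w ∷ zs) (++-assoc as (u ∷ p) _)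
  x≢w : x ≢ w
  x≢w = distinct (as ++ u ∷ p) x q w zs refl
  u≢w : u ≢ w
  u≢w = distinct as u (p ++ x ∷ q) w zs
    (trans (++-assoc as (u ∷ p) _) (cong (λ L → as ++ u ∷ L) (sym (++-assoc p (x ∷ q) _))))

  u∈ : u ∈ (as ++ u ∷ p) ∷ʳ x
  u∈ = ∈-++⁺ˡ (∈-++⁺ʳ as (here refl))
  w∈ : w ∈ x ∷ q ++ w ∷ zs
  w∈ = there (∈-++⁺ʳ q (here refl))

  u-bounds : 1 ≤ u × u ≤ n
  u-bounds = labels-bounded n inT (All.lookup in₁ u∈)
  x-bounds : 1 ≤ x × x ≤ n
  x-bounds = labels-bounded n inT (All.lookup in₂ (here refl))
  w-bounds : 1 ≤ w × w ≤ n
  w-bounds = labels-bounded n inT (All.lookup in₂ w∈)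

  u≢1 : u ≢ 1
  u≢1 u≡1 = case one of λ where
    (inj₁ x≡1)      → u≢x (trans u≡1 (sym x≡1))
    (inj₂ (1∉ , _)) → 1∉ (subst (_∈ (as ++ u ∷ p) ∷ʳ x) u≡1 u∈)
  w≢1 : w ≢ 1
  w≢1 w≡1 = case one of λ where
    (inj₁ x≡1)      → x≢w (trans x≡1 (sym w≡1))
    (inj₂ (_ , 1∉)) → 1∉ (subst (_∈ x ∷ q ++ w ∷ zs) w≡1 w∈)

lemma4p4 : (n : ℕ) (S : Deformation) → AlmostTransitive n S →
    (T : Tree (suc (maxShift n S))) → InTrees n T →
    (xs : List ℕ) (x : ℕ) (ys : List ℕ) →
    IsSCadetSeq S T (xs ∷ʳ x) → IsSCadetSeq S T (x ∷ ys) →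
    (x ≡ 1 ⊎ (1 ∉ (xs ∷ʳ x) × 1 ∉ (x ∷ ys))) →
    IsSCadetSeq S T (xs ++ x ∷ ys)
lemma4p4 n S at T inT xs x ys seq₁@((in₁ , adj₁) , ord₁) seq₂@((in₂ , adj₂) , ord₂) one =
  (All.++⁺ (All.++⁻ˡ xs in₁) in₂ , Adjacent-++-∷ adj₁ adj₂) ,
  OrderedPairs-++-∷ ord₁ ord₂ (IsSCadetSeq-straddle at inT seq₁ seq₂ one)
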